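{- Let $k\geq 2$ be odd, $2\leq x\leq k-1$, $n=k+x$, with $(x,n)\notin\{(1,4),(1,6)\}$. Then $\lambda^k(\overrightarrow{C_n})\geq x$.
   Context: $\overrightarrow{C_n}$ is the directed cycle (circuit) on $n$ vertices and $\overleftrightarrow{K_n}$ the complete digraph on $n$ vertices (all arcs $(u,v)$, $u\ne v$). A $p$-labeled packing of $k$ copies of $\overrightarrow{C_n}$ is a map $f$ from $V(\overleftrightarrow{K_n})$ onto a set of exactly $p$ labels together with injections $\sigma_1,\dots,\sigma_k:V(\overrightarrow{C_n})\to V(\overleftrightarrow{K_n})$ such that for $i\neq j$ the induced arc images are disjoint, and for every vertex $v$, $f(\sigma_1(v))=\dots=f(\sigma_k(v))$. $\lambda^k(\overrightarrow{C_n})$ is the largest $p$ for which such a packing exists. -}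

module Defs where

open import Data.Nat using (ℕ; suc; _≤_)
open import Data.Fin using (Fin; toℕ)
open import Data.Product using (Σ; ∃; _×_; _,_)
open import Data.Sum using (_⊎_)
open import Relation.Binary.PropositionalEquality using (_≡_; _≢_)
open import Relation.Nullary using (¬_)
open import Function.Definitions using (Injective; Surjective)

CycleArc : (n : ℕ) → Fin n → Fin n → Set
CycleArc n u v = (suc (toℕ u) ≡ toℕ v) ⊎ ((suc (toℕ u) ≡ n) × (toℕ v ≡ 0))

record LabeledPacking (p k n : ℕ) : Set where
  field
    label     : Fin n → Fin p
    label-onto : Surjective _≡_ _≡_ label
    σ         : Fin k → Fin n → Fin n
    σ-inj     : ∀ i → Injective _≡_ _≡_ (σ i)
    disjoint  : ∀ i j → i ≢ j → ∀ a b c d → CycleArc n a b → CycleArc n c d →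
                ¬ ((σ i a ≡ σ j c) × (σ i b ≡ σ j d))
    compatible : ∀ i j v → label (σ i v) ≡ label (σ j v)

-- λ^k(C_n) ≥ x  :⇔  some p ≥ x admits a p-labeled packing of k copies of C_n
-- (λ^k is the largest such p, and p ≤ n always).
λ≥ : (k n x : ℕ) → Set
λ≥ k n x = Σ ℕ λ p → (x ≤ p) × LabeledPacking p k n

-- Put f = x ∸ 1, so n = (k + 1) + f.  As k + 1 is even, ℤ/(k + 1) has a sequencing, the
-- zigzag 0, k, 1, k ∸ 1, …: a Hamiltonian path with pairwise distinct differences, so its k
-- translates are pairwise arc-disjoint.  Interleave f new vertices, fixed by every translate,
-- into the end of the path so that C_n closes through a fixed vertex; the arcs at a fixed vertex
-- stay disjoint because their other endpoint is translated.  One label for ℤ/(k + 1) and one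
-- for each fixed vertex give f + 1 = x labels.
module Submission where

open import Defs
open import Data.Nat using (ℕ; _+_; _≤_; _∸_; _%_)
open import Data.Product using (_×_; _,_)
open import Relation.Binary.PropositionalEquality using (_≡_)
open import Relation.Nullary using (¬_)

open import Data.Nat using (zero; suc; _*_; _<_; s≤s; s≤s⁻¹; z<s; _<?_; _/_; NonZero; ⌊_/2⌋; ⌈_/2⌉)
open import Data.Nat.Properties
open import Data.Nat.DivMod using (_mod_; [m+kn]%n≡m%n; [m+n]%n≡m%n; %-distribˡ-+; m<n⇒m%n≡m; m≡m%n+[m/n]*n)
open import Data.Nat.Tactic.RingSolver using (solve-∀)
open import Data.Fin using (Fin; toℕ; fromℕ<; splitAt; join)
import Data.Fin as Fin
open import Data.Fin.Properties using (toℕ<n; toℕ-injective; fromℕ<-injective; splitAt-join)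
open import Data.Product using (∃)
open import Data.Sum using (_⊎_; inj₁; inj₂; [_,_]′)
open import Data.Sum.Properties using (inj₁-injective; inj₂-injective)
open import Data.Empty using (⊥; ⊥-elim)
open import Relation.Nullary using (yes; no)
open import Function.Definitions using (Surjective)
open import Relation.Binary.PropositionalEquality
  using (refl; sym; trans; cong; subst; subst₂; _≢_; module ≡-Reasoning)

data Parity (s : ℕ) : Set where
  even : (t : ℕ) → s ≡ t + t → Parity s
  odd  : (t : ℕ) → s ≡ suc (t + t) → Parity s

parity : ∀ s → Parity s
parity zero = even 0 refl
parity (suc s) with parity s
... | even t e = odd t (cong suc e)
... | odd t e = even (suc t) (cong suc (trans e (sym (+-suc t t))))

double-injective : ∀ t u → t + t ≡ u + u → t ≡ u
double-injective t u e = trans (n≡⌊n+n/2⌋ t) (trans (cong ⌊_/2⌋ e) (sym (n≡⌊n+n/2⌋ u)))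

double≢1+double : ∀ t u → t + t ≢ suc (u + u)
double≢1+double t u e = 1+n≢n (sym (begin
  u                  ≡⟨ n≡⌈n+n/2⌉ u ⟩
  ⌈ u + u /2⌉        ≡⟨ cong ⌊_/2⌋ e ⟨
  ⌊ t + t /2⌋        ≡⟨ n≡⌊n+n/2⌋ t ⟨
  t                  ≡⟨ n≡⌈n+n/2⌉ t ⟩
  ⌈ t + t /2⌉        ≡⟨ cong ⌈_/2⌉ e ⟩
  suc ⌊ u + u /2⌋    ≡⟨ cong suc (n≡⌊n+n/2⌋ u) ⟨
  suc u              ∎))
  where open ≡-Reasoning

double-cancel-≤ : ∀ {t u} → t + t ≤ suc (u + u) → t ≤ u
double-cancel-≤ {t} {u} le =
  subst₂ _≤_ (sym (n≡⌊n+n/2⌋ t)) (sym (n≡⌈n+n/2⌉ u)) (⌊n/2⌋-mono le)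

double-cancel-< : ∀ {t u} → t + t < u + u → t < u
double-cancel-< {t} {u} lt =
  double-cancel-≤ (subst (_≤ suc (u + u)) (cong suc (sym (+-suc t t))) (s≤s lt))

odd⇒1+double : ∀ k → k % 2 ≡ 1 → ∃ λ q → k ≡ suc (q + q)
odd⇒1+double k k-odd = k / 2 , (begin
  k                      ≡⟨ m≡m%n+[m/n]*n k 2 ⟩
  k % 2 + k / 2 * 2      ≡⟨ cong (_+ k / 2 * 2) k-odd ⟩
  suc (k / 2 * 2)        ≡⟨ cong suc (*2≡double (k / 2)) ⟩
  suc (k / 2 + k / 2)    ∎)
  where
    open ≡-Reasoning
    *2≡double : ∀ a → a * 2 ≡ a + a
    *2≡double = solve-∀

%-cong-+ʳ : ∀ {m} .{{_ : NonZero m}} a b c → a % m ≡ b % m → (a + c) % m ≡ (b + c) % m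
%-cong-+ʳ {m} a b c e = begin
  (a + c) % m              ≡⟨ %-distribˡ-+ a c m ⟩
  (a % m + c % m) % m      ≡⟨ cong (λ z → (z + c % m) % m) e ⟩
  (b % m + c % m) % m      ≡⟨ %-distribˡ-+ b c m ⟨
  (b + c) % m              ∎
  where open ≡-Reasoning

%-cancel-+ʳ : ∀ {m} .{{_ : NonZero m}} a b c → (a + c) % m ≡ (b + c) % m → a % m ≡ b % m
%-cancel-+ʳ {m@(suc m-1)} a b c e = begin
  a % m                    ≡⟨ [m+kn]%n≡m%n a c m ⟨
  (a + c * m) % m          ≡⟨ cong (_% m) (regroup a) ⟩
  (a + c + c * m-1) % m    ≡⟨ %-cong-+ʳ (a + c) (b + c) (c * m-1) e ⟩
  (b + c + c * m-1) % m    ≡⟨ cong (_% m) (regroup b) ⟨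
  (b + c * m) % m          ≡⟨ [m+kn]%n≡m%n b c m ⟩
  b % m                    ∎
  where
    open ≡-Reasoning
    regroup : ∀ x → x + c * m ≡ x + c + c * m-1
    regroup x = trans (cong (x +_) (*-suc c m-1)) (sym (+-assoc x c (c * m-1)))

%-cancel-+ˡ : ∀ {m} .{{_ : NonZero m}} a b c → (c + a) % m ≡ (c + b) % m → a % m ≡ b % m
%-cancel-+ˡ {m} a b c e =
  %-cancel-+ʳ a b c (subst₂ (λ x y → x % m ≡ y % m) (+-comm c a) (+-comm c b) e)

%-injective-< : ∀ {m} .{{_ : NonZero m}} {a b} → a < m → b < m → a % m ≡ b % m → a ≡ b
%-injective-< a<m b<m e = trans (sym (m<n⇒m%n≡m a<m)) (trans e (m<n⇒m%n≡m b<m))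

record Sequencing (k : ℕ) : Set where
  field
    term           : ℕ → ℕ
    gap            : ℕ → ℕ
    term<          : ∀ {s} → s < suc k → term s < suc k
    term-injective : ∀ {s s′} → s < suc k → s′ < suc k → term s ≡ term s′ → s ≡ s′
    gap<           : ∀ {s} → s < k → gap s < suc k
    gap-injective  : ∀ {s s′} → s < k → s′ < k → gap s ≡ gap s′ → s ≡ s′
    term-step      : ∀ {s} → s < k → (term s + gap s) % suc k ≡ term (suc s) % suc k

  translates-arc-disjoint : ∀ i j {s s′} → s < k → s′ < k →
    (term s + i) % suc k ≡ (term s′ + j) % suc k →
    (term (suc s) + i) % suc k ≡ (term (suc s′) + j) % suc k → s ≡ s′
  translates-arc-disjoint i j {s} {s′} s<k s′<k tail-eq head-eq =
    gap-injective s<k s′<k (%-injective-< (gap< s<k) (gap< s′<k)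
      (%-cancel-+ˡ (gap s) (gap s′) (term s′ + j)
        (trans (sym (%-cong-+ʳ (term s + i) (term s′ + j) (gap s) tail-eq)) steps)))
    where
      open ≡-Reasoning
      swap : ∀ a b c → a + b + c ≡ a + c + b
      swap = solve-∀
      step+ : ∀ {r} → r < k → ∀ x → (term r + gap r + x) % suc k ≡ (term (suc r) + x) % suc k
      step+ {r} r<k x = %-cong-+ʳ (term r + gap r) (term (suc r)) x (term-step r<k)
      steps : (term s + i + gap s) % suc k ≡ (term s′ + j + gap s′) % suc k
      steps = begin
        (term s + i + gap s) % suc k        ≡⟨ cong (_% suc k) (swap (term s) i (gap s)) ⟩
        (term s + gap s + i) % suc k        ≡⟨ step+ s<k i ⟩
        (term (suc s) + i) % suc k          ≡⟨ head-eq ⟩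
        (term (suc s′) + j) % suc k         ≡⟨ step+ s′<k j ⟨
        (term s′ + gap s′ + j) % suc k      ≡⟨ cong (_% suc k) (swap (term s′) (gap s′) j) ⟩
        (term s′ + j + gap s′) % suc k      ∎

-- The zigzag 0, k, 1, k ∸ 1, 2, …: the step out of position t + t is k ∸ (t + t), the step out
-- of position 1 + (t + t) is (1 + t) − (k ∸ t) ≡ 2 + (t + t) modulo 1 + k; since k is odd these
-- are all distinct.
module Zigzag (q : ℕ) where
  k : ℕ
  k = suc (q + q)

  half : ∀ {s} → Parity s → ℕ
  half (even t _) = t
  half (odd t _) = t

  termOf : ∀ {s} → Parity s → ℕ
  termOf (even t _) = t
  termOf (odd t _) = k ∸ t

  gapOf : ∀ {s} → Parity s → ℕ
  gapOf (even t _) = k ∸ (t + t)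
  gapOf (odd t _) = suc (suc (t + t))

  half≤q : ∀ {s} → s < suc k → (p : Parity s) → half p ≤ q
  half≤q s<m (even t e) = double-cancel-≤ (s≤s⁻¹ (subst (_< suc k) e s<m))
  half≤q s<m (odd t e) = double-cancel-≤ (≤-trans (n≤1+n _) (s≤s⁻¹ (subst (_< suc k) e s<m)))

  half≤k : ∀ {s} → s < suc k → (p : Parity s) → half p ≤ k
  half≤k s<m p = m≤n⇒m≤1+n (≤-trans (half≤q s<m p) (m≤m+n q q))

  double≤k : ∀ {s} t → s < k → s ≡ t + t → t + t ≤ k
  double≤k _ s<k e = subst (_≤ k) e (<⇒≤ s<k)

  half≢k∸half : ∀ {t t′} → t ≤ q → t′ ≤ q → t ≢ k ∸ t′
  half≢k∸half {t} {t′} t≤q t′≤q t≡k∸t′ = 1+n≰n (subst (_≤ q + q) t+t′≡k (+-mono-≤ t≤q t′≤q))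
    where
      t+t′≡k : t + t′ ≡ k
      t+t′≡k = trans (cong (_+ t′) t≡k∸t′) (m∸n+n≡m (m≤n⇒m≤1+n (≤-trans t′≤q (m≤m+n q q))))

  k∸double≢2+double : ∀ {t t′} → t + t ≤ k → k ∸ (t + t) ≢ suc (suc (t′ + t′))
  k∸double≢2+double {t} {t′} le eq = double≢1+double q (t′ + t) (suc-injective (begin
    k                               ≡⟨ m∸n+n≡m le ⟨
    k ∸ (t + t) + (t + t)           ≡⟨ cong (_+ (t + t)) eq ⟩
    suc (suc (t′ + t′)) + (t + t)   ≡⟨ regroup t′ t ⟩
    suc (suc (t′ + t + (t′ + t)))   ∎))
    where
      open ≡-Reasoning
      regroup : ∀ a b → suc (suc (a + a)) + (b + b) ≡ suc (suc (a + b + (a + b)))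
      regroup = solve-∀

  termOf-< : ∀ {s} → s < suc k → (p : Parity s) → termOf p < suc k
  termOf-< s<m (even t e) = ≤-<-trans (m≤m+n t t) (subst (_< suc k) e s<m)
  termOf-< s<m (odd t e) = s≤s (m∸n≤m k t)

  termOf-injective : ∀ {s s′} → s < suc k → s′ < suc k → (p : Parity s) (p′ : Parity s′) →
                     termOf p ≡ termOf p′ → s ≡ s′
  termOf-injective _ _ (even t e) (even t′ e′) h = trans e (trans (cong (λ z → z + z) h) (sym e′))
  termOf-injective l l′ p@(odd t e) p′@(odd t′ e′) h =
    trans e (trans (cong (λ z → suc (z + z)) (∸-cancelˡ-≡ (half≤k l p) (half≤k l′ p′) h)) (sym e′))
  termOf-injective l l′ p@(even _ _) p′@(odd _ _) h =
    ⊥-elim (half≢k∸half (half≤q l p) (half≤q l′ p′) h)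
  termOf-injective l l′ p@(odd _ _) p′@(even _ _) h =
    ⊥-elim (half≢k∸half (half≤q l′ p′) (half≤q l p) (sym h))

  termOf-step : ∀ {s} → s < k → (p : Parity s) (p′ : Parity (suc s)) →
                (termOf p + gapOf p) % suc k ≡ termOf p′ % suc k
  termOf-step s<k (even t e) (odd t′ e′) = cong (_% suc k) (begin
    t + (k ∸ (t + t))       ≡⟨ +-∸-assoc t (double≤k t s<k e) ⟨
    t + k ∸ (t + t)         ≡⟨ [m+n]∸[m+o]≡n∸o t k t ⟩
    k ∸ t                   ≡⟨ cong (k ∸_) t≡t′ ⟩
    k ∸ t′                  ∎)
    where
      open ≡-Reasoning
      t≡t′ : t ≡ t′
      t≡t′ = double-injective t t′ (suc-injective (trans (sym (cong suc e)) e′))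
  termOf-step s<k p@(odd t e) (even t′ e′) = begin
    (k ∸ t + suc (suc (t + t))) % suc k    ≡⟨ cong (_% suc k) (regroup (k ∸ t) t) ⟩
    (suc t + suc (k ∸ t + t)) % suc k      ≡⟨ cong (λ z → (suc t + suc z) % suc k) k∸t+t≡k ⟩
    (suc t + suc k) % suc k                ≡⟨ [m+n]%n≡m%n (suc t) (suc k) ⟩
    suc t % suc k                          ≡⟨ cong (_% suc k) 1+t≡t′ ⟩
    t′ % suc k                             ∎
    where
      open ≡-Reasoning
      regroup : ∀ r t → r + suc (suc (t + t)) ≡ suc t + suc (r + t)
      regroup = solve-∀
      k∸t+t≡k : k ∸ t + t ≡ k
      k∸t+t≡k = m∸n+n≡m (half≤k (m≤n⇒m≤1+n s<k) p)
      1+t≡t′ : suc t ≡ t′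
      1+t≡t′ = double-injective (suc t) t′ (trans (cong suc (+-suc t t)) (trans (sym (cong suc e)) e′))
  termOf-step _ (even t e) (even t′ e′) = ⊥-elim (double≢1+double t′ t (trans (sym e′) (cong suc e)))
  termOf-step _ (odd t e) (odd t′ e′) =
    ⊥-elim (double≢1+double t′ t (suc-injective (trans (sym e′) (cong suc e))))

  gapOf-< : ∀ {s} → s < k → (p : Parity s) → gapOf p < suc k
  gapOf-< _ (even t e) = s≤s (m∸n≤m k (t + t))
  gapOf-< s<k (odd t e) = s≤s (subst (λ z → suc z ≤ k) e s<k)

  gapOf-injective : ∀ {s s′} → s < k → s′ < k → (p : Parity s) (p′ : Parity s′) →
                    gapOf p ≡ gapOf p′ → s ≡ s′
  gapOf-injective l l′ (even t e) (even t′ e′) h =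
    trans e (trans (∸-cancelˡ-≡ (double≤k t l e) (double≤k t′ l′ e′) h) (sym e′))
  gapOf-injective _ _ (odd t e) (odd t′ e′) h =
    trans e (trans (cong suc (suc-injective (suc-injective h))) (sym e′))
  gapOf-injective l _ (even t e) (odd t′ e′) h = ⊥-elim (k∸double≢2+double {t} {t′} (double≤k t l e) h)
  gapOf-injective _ l′ (odd t e) (even t′ e′) h =
    ⊥-elim (k∸double≢2+double {t′} {t} (double≤k t′ l′ e′) (sym h))

zigzag : ∀ q → Sequencing (suc (q + q))
zigzag q = record
  { term           = λ s → termOf (parity s)
  ; gap            = λ s → gapOf (parity s)
  ; term<          = λ {s} l → termOf-< l (parity s)
  ; term-injective = λ {s} {s′} l l′ → termOf-injective l l′ (parity s) (parity s′)
  ; gap<           = λ {s} l → gapOf-< l (parity s)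
  ; gap-injective  = λ {s} {s′} l l′ → gapOf-injective l l′ (parity s) (parity s′)
  ; term-step      = λ {s} l → termOf-step l (parity s) (parity (suc s))
  }
  where open Zigzag q

cycleArc-functional : ∀ {n} {a b b′ : Fin n} → CycleArc n a b → CycleArc n a b′ → b ≡ b′
cycleArc-functional (inj₁ e) (inj₁ e′) = toℕ-injective (trans (sym e) e′)
cycleArc-functional {b = b} (inj₁ e) (inj₂ (e′ , _)) = ⊥-elim (<⇒≢ (toℕ<n b) (trans (sym e) e′))
cycleArc-functional {b′ = b′} (inj₂ (e , _)) (inj₁ e′) = ⊥-elim (<⇒≢ (toℕ<n b′) (trans (sym e′) e))
cycleArc-functional (inj₂ (_ , b≡0)) (inj₂ (_ , b′≡0)) = toℕ-injective (trans b≡0 (sym b′≡0))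

cycleArc-injective : ∀ {n} {a a′ b : Fin n} → CycleArc n a b → CycleArc n a′ b → a ≡ a′
cycleArc-injective (inj₁ e) (inj₁ e′) = toℕ-injective (suc-injective (trans e (sym e′)))
cycleArc-injective (inj₁ e) (inj₂ (_ , b≡0)) = ⊥-elim (1+n≢0 (trans e b≡0))
cycleArc-injective (inj₂ (_ , b≡0)) (inj₁ e) = ⊥-elim (1+n≢0 (trans e b≡0))
cycleArc-injective (inj₂ (e , _)) (inj₂ (e′ , _)) = toℕ-injective (suc-injective (trans e (sym e′)))

join-injective : ∀ m n {x y : Fin m ⊎ Fin n} → join m n x ≡ join m n y → x ≡ y
join-injective m n {x} {y} e =
  trans (sym (splitAt-join m n x)) (trans (cong (splitAt m) e) (splitAt-join m n y))

-- The vertices of C_{P + 2f} are given roles: positions a < P carry rotating vertex a, position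
-- P + 2t carries rotating vertex P + t and position P + 2t + 1 the fixed vertex t.  So the
-- rotating vertices 0, …, k follow the cycle in order, and a fixed vertex sits after each of the
-- last f of them; in particular the closing arc leaves a fixed vertex.
module Layout (k g P : ℕ) (P+f≡1+k : P + suc g ≡ suc k) where
  f n : ℕ
  f = suc g
  n = suc k + f

  n≡P+2f : n ≡ P + (f + f)
  n≡P+2f = trans (cong (_+ f) (sym P+f≡1+k)) (+-assoc P f f)

  P≤k : P ≤ k
  P≤k = s≤s⁻¹ (subst (P <_) P+f≡1+k (m<m+n P z<s))

  P<n : P < n
  P<n = s≤s (≤-trans P≤k (m≤m+n k f))

  data Role : Set where
    rot : ℕ → Role
    fix : Fin f → Role

  rot-injective : ∀ {s s′} → rot s ≡ rot s′ → s ≡ s′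
  rot-injective refl = refl

  fix-injective : ∀ {t t′} → fix t ≡ fix t′ → t ≡ t′
  fix-injective refl = refl

  data View (a : ℕ) : Set where
    head : a < P → View a
    even : (t : ℕ) → t < f → a ≡ P + (t + t) → View a
    odd  : (t : ℕ) → t < f → a ≡ P + suc (t + t) → View a

  above-P : ∀ {a r} → ¬ a < P → a ∸ P ≡ r → a ≡ P + r
  above-P a≮P e = trans (sym (m+[n∸m]≡n (≮⇒≥ a≮P))) (cong (P +_) e)

  offset<2f : ∀ {a r} → a < n → a ≡ P + r → r < f + f
  offset<2f a<n e = +-cancelˡ-< P _ _ (subst₂ _<_ e n≡P+2f a<n)

  view : (u : Fin n) → View (toℕ u)
  view u with toℕ u <? P
  ... | yes a<P = head a<P
  ... | no a≮P with parity (toℕ u ∸ P)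
  ...   | even t e =
    even t (double-cancel-< (offset<2f (toℕ<n u) (above-P a≮P e))) (above-P a≮P e)
  ...   | odd t e =
    odd t (double-cancel-< (<-trans (n<1+n _) (offset<2f (toℕ<n u) (above-P a≮P e)))) (above-P a≮P e)

  roleOf : ∀ {a} → View a → Role
  roleOf {a} (head _) = rot a
  roleOf (even t _ _) = rot (P + t)
  roleOf (odd _ t<f _) = fix (fromℕ< t<f)

  roleOf-rot< : ∀ {a s} (v : View a) → roleOf v ≡ rot s → s < suc k
  roleOf-rot< (head a<P) refl = <-≤-trans a<P (m≤n⇒m≤1+n P≤k)
  roleOf-rot< (even t t<f _) refl = subst (P + t <_) P+f≡1+k (+-monoʳ-< P t<f)

  roleOf-injective : ∀ {a b} (v : View a) (w : View b) → roleOf v ≡ roleOf w → a ≡ b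
  roleOf-injective (head _) (head _) refl = refl
  roleOf-injective (head a<P) (even t _ _) refl = ⊥-elim (<⇒≱ a<P (m≤m+n P t))
  roleOf-injective (even t _ _) (head b<P) refl = ⊥-elim (<⇒≱ b<P (m≤m+n P t))
  roleOf-injective (even t _ e) (even t′ _ e′) h =
    trans e (trans (cong (λ z → P + (z + z)) (+-cancelˡ-≡ P t t′ (rot-injective h))) (sym e′))
  roleOf-injective (odd t t<f e) (odd t′ t′<f e′) h =
    trans e (trans (cong (λ z → P + suc (z + z)) (fromℕ<-injective t t′ t<f t′<f (fix-injective h)))
                   (sym e′))
  roleOf-injective (head _) (odd _ _ _) ()
  roleOf-injective (even _ _ _) (odd _ _ _) ()
  roleOf-injective (odd _ _ _) (head _) ()
  roleOf-injective (odd _ _ _) (even _ _ _) ()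

  rot-arc : ∀ {u w : Fin n} {s s′} → CycleArc n u w → (v : View (toℕ u)) (v′ : View (toℕ w)) →
            roleOf v ≡ rot s → roleOf v′ ≡ rot s′ → s < k × s′ ≡ suc s
  rot-arc _ (odd _ _ _) _ () _
  rot-arc _ _ (odd _ _ _) _ ()
  rot-arc (inj₁ e) (head a<P) (head _) refl refl = <-≤-trans a<P P≤k , sym e
  rot-arc (inj₁ e) (head a<P) (even zero _ e′) refl refl = <-≤-trans a<P P≤k , sym (trans e e′)
  rot-arc (inj₁ e) (head a<P) (even (suc t) _ e′) refl refl =
    ⊥-elim (<⇒≱ (m<m+n P z<s) (subst (_≤ P) (trans e e′) a<P))
  rot-arc (inj₁ e) (even t _ e₀) (head b<P) refl refl =
    ⊥-elim (<⇒≱ b<P (subst (P ≤_) (trans (cong suc (sym e₀)) e) (m≤n⇒m≤1+n (m≤m+n P (t + t)))))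
  rot-arc (inj₁ e) (even t _ e₀) (even t′ _ e₁) refl refl =
    ⊥-elim (double≢1+double t′ t (+-cancelˡ-≡ P _ _
      (trans (sym e₁) (trans (sym e) (trans (cong suc e₀) (sym (+-suc P (t + t))))))))
  rot-arc (inj₂ (last , _)) (head a<P) _ refl _ = ⊥-elim (<⇒≢ (≤-<-trans a<P P<n) last)
  rot-arc (inj₂ (last , _)) (even t _ e₀) _ refl _ =
    ⊥-elim (double≢1+double f t (+-cancelˡ-≡ P _ _
      (trans (sym n≡P+2f) (trans (sym last) (trans (cong suc e₀) (sym (+-suc P (t + t))))))))

  fix-fix-nonadjacent : ∀ {u w : Fin n} {t t′} → CycleArc n u w →
                        (v : View (toℕ u)) (v′ : View (toℕ w)) →
                        roleOf v ≡ fix t → roleOf v′ ≡ fix t′ → ⊥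
  fix-fix-nonadjacent _ (head _) _ () _
  fix-fix-nonadjacent _ (even _ _ _) _ () _
  fix-fix-nonadjacent _ _ (head _) _ ()
  fix-fix-nonadjacent _ _ (even _ _ _) _ ()
  fix-fix-nonadjacent (inj₁ e) (odd t _ e₀) (odd t′ _ e₁) _ _ =
    double≢1+double t′ t (suc-injective (+-cancelˡ-≡ P _ _
      (trans (sym e₁) (trans (sym e) (trans (cong suc e₀) (sym (+-suc P (suc (t + t)))))))))
  fix-fix-nonadjacent (inj₂ (_ , w≡0)) (odd _ _ _) (odd _ _ e₁) _ _ =
    1+n≢0 (trans (sym (+-suc P _)) (trans (sym e₁) w≡0))

-- The complete digraph has vertex set ℤ/(suc k) ⊎ Fin f, and all of ℤ/(suc k) shares one label.
module RotationalPacking {k} (S : Sequencing k) (g P : ℕ) (P+f≡1+k : P + suc g ≡ suc k)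
                         (c : ℕ) (c≤1+k : c ≤ suc k) where
  open Sequencing S
  open Layout k g P P+f≡1+k

  copy : ℕ → Role → Fin (suc k) ⊎ Fin f
  copy i (rot s) = inj₁ ((term s + i) mod suc k)
  copy i (fix t) = inj₂ t

  role : Fin n → Role
  role u = roleOf (view u)

  role-injective : ∀ {u w} → role u ≡ role w → u ≡ w
  role-injective {u} {w} e = toℕ-injective (roleOf-injective (view u) (view w) e)

  copy-rot⇒%≡ : ∀ {i j s s′} → copy i (rot s) ≡ copy j (rot s′) →
                (term s + i) % suc k ≡ (term s′ + j) % suc k
  copy-rot⇒%≡ {i} {j} {s} {s′} e =
    fromℕ<-injective ((term s + i) % suc k) ((term s′ + j) % suc k) _ _ (inj₁-injective e)

  translation-injective : ∀ {i j s} → i < suc k → j < suc k → copy i (rot s) ≡ copy j (rot s) → i ≡ j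
  translation-injective {i} {j} {s} i<m j<m e =
    %-injective-< i<m j<m (%-cancel-+ˡ i j (term s) (copy-rot⇒%≡ e))

  copy-role-injective : ∀ i u w → copy i (role u) ≡ copy i (role w) → u ≡ w
  copy-role-injective i u w e with role u in eu | role w in ew
  ... | rot s | rot s′ = role-injective (trans eu (trans (cong rot s≡s′) (sym ew)))
    where
      s<m : s < suc k
      s<m = roleOf-rot< (view u) eu
      s′<m : s′ < suc k
      s′<m = roleOf-rot< (view w) ew
      s≡s′ : s ≡ s′
      s≡s′ = term-injective s<m s′<m
        (%-injective-< (term< s<m) (term< s′<m) (%-cancel-+ʳ (term s) (term s′) i (copy-rot⇒%≡ e)))
  ... | fix t | fix t′ = role-injective (trans eu (trans (cong fix (inj₂-injective e)) (sym ew)))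
  copy-role-injective i u w () | rot _ | fix _
  copy-role-injective i u w () | fix _ | rot _

  module _ {i j} (i<m : i < suc k) (j<m : j < suc k) {a b a′ b′ : Fin n}
           (ab : CycleArc n a b) (a′b′ : CycleArc n a′ b′) where

    translates-disjoint : ∀ ra rb ra′ rb′ →
                          role a ≡ ra → role b ≡ rb → role a′ ≡ ra′ → role b′ ≡ rb′ →
                          copy i ra ≡ copy j ra′ → copy i rb ≡ copy j rb′ → i ≡ j
    translates-disjoint (fix _) (fix _) _ _ ea eb _ _ _ _ =
      ⊥-elim (fix-fix-nonadjacent ab (view a) (view b) ea eb)
    translates-disjoint (fix _) (rot s) (fix _) rb′ ea eb ea′ eb′ refl head-eq =
      translation-injective i<m j<m (trans head-eq (cong (copy j) rb′≡rot-s))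
      where
        a≡a′ : a ≡ a′
        a≡a′ = role-injective (trans ea (sym ea′))
        b≡b′ : b ≡ b′
        b≡b′ = cycleArc-functional ab (subst (λ z → CycleArc n z b′) (sym a≡a′) a′b′)
        rb′≡rot-s : rb′ ≡ rot s
        rb′≡rot-s = trans (sym eb′) (trans (cong role (sym b≡b′)) eb)
    translates-disjoint (rot s) (fix _) ra′ (fix _) ea eb ea′ eb′ tail-eq refl =
      translation-injective i<m j<m (trans tail-eq (cong (copy j) ra′≡rot-s))
      where
        b≡b′ : b ≡ b′
        b≡b′ = role-injective (trans eb (sym eb′))
        a≡a′ : a ≡ a′
        a≡a′ = cycleArc-injective ab (subst (CycleArc n a′) (sym b≡b′) a′b′)
        ra′≡rot-s : ra′ ≡ rot s
        ra′≡rot-s = trans (sym ea′) (trans (cong role (sym a≡a′)) ea)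
    translates-disjoint (rot s) (rot _) (rot u) (rot _) ea eb ea′ eb′ tail-eq head-eq
      with rot-arc ab (view a) (view b) ea eb | rot-arc a′b′ (view a′) (view b′) ea′ eb′
    ... | s<k , refl | u<k , refl
      with translates-arc-disjoint i j s<k u<k (copy-rot⇒%≡ tail-eq) (copy-rot⇒%≡ head-eq)
    ... | refl = translation-injective i<m j<m tail-eq
    translates-disjoint (fix _) (rot _) (rot _) _ _ _ _ _ () _
    translates-disjoint (rot _) (fix _) _ (rot _) _ _ _ _ _ ()
    translates-disjoint (rot _) (rot _) (fix _) _ _ _ _ _ () _
    translates-disjoint (rot _) (rot _) (rot _) (fix _) _ _ _ _ _ ()

  index< : (i : Fin c) → toℕ i < suc k
  index< i = <-≤-trans (toℕ<n i) c≤1+k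

  σ : Fin c → Fin n → Fin n
  σ i u = join (suc k) f (copy (toℕ i) (role u))

  collapse : Fin (suc k) ⊎ Fin f → Fin (suc f)
  collapse = [ (λ _ → Fin.zero) , Fin.suc ]′

  label : Fin n → Fin (suc f)
  label u = collapse (splitAt (suc k) u)

  label-join : ∀ x → label (join (suc k) f x) ≡ collapse x
  label-join x = cong collapse (splitAt-join (suc k) f x)

  collapse-copy : ∀ i j r → collapse (copy i r) ≡ collapse (copy j r)
  collapse-copy i j (rot _) = refl
  collapse-copy i j (fix _) = refl

  label-onto : Surjective _≡_ _≡_ label
  label-onto Fin.zero = join (suc k) f (inj₁ Fin.zero) , λ { refl → label-join (inj₁ Fin.zero) }
  label-onto (Fin.suc t) = join (suc k) f (inj₂ t) , λ { refl → label-join (inj₂ t) }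

  packing : LabeledPacking (suc f) c n
  packing = record
    { label      = label
    ; label-onto = label-onto
    ; σ          = σ
    ; σ-inj      = λ i {u} {w} e → copy-role-injective (toℕ i) u w (join-injective (suc k) f e)
    ; disjoint   = λ i j i≢j a b a′ b′ ab a′b′ (h₁ , h₂) → i≢j (toℕ-injective
        (translates-disjoint (index< i) (index< j) ab a′b′ _ _ _ _ refl refl refl refl
          (join-injective (suc k) f h₁) (join-injective (suc k) f h₂)))
    ; compatible = λ i j v →
        trans (label-join (copy (toℕ i) (role v)))
          (trans (collapse-copy (toℕ i) (toℕ j) (role v)) (sym (label-join (copy (toℕ j) (role v)))))
    }

rotationalPacking : ∀ {k c f} → Sequencing k → 0 < f → f ≤ suc k → c ≤ suc k →
                    LabeledPacking (suc f) c (suc k + f)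
rotationalPacking {k} {c} {suc g} S _ f≤1+k c≤1+k =
  RotationalPacking.packing S g (suc k ∸ suc g) (m∸n+n≡m f≤1+k) c c≤1+k

-- The excluded pairs contradict 2 ≤ x, and x ≤ k ∸ 1 is only used in the weaker form x ≤ k + 2.
mainTheorem10 : (k x n : ℕ) → 2 ≤ k → k % 2 ≡ 1 → 2 ≤ x → x ≤ k ∸ 1 → n ≡ k + x →
    ¬ ((x ≡ 1) × (n ≡ 4)) → ¬ ((x ≡ 1) × (n ≡ 6)) → λ≥ k n x
mainTheorem10 k (suc (suc g)) n _ k-odd (s≤s (s≤s _)) x≤k∸1 n≡k+x _ _ with odd⇒1+double k k-odd
... | q , refl =
  suc (suc g) , ≤-refl ,
  subst (LabeledPacking (suc (suc g)) k) n≡ (rotationalPacking (zigzag q) z<s f≤1+k (n≤1+n k))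
  where
    f≤1+k : suc g ≤ suc k
    f≤1+k = ≤-trans (n≤1+n _) (≤-trans x≤k∸1 (≤-trans (n≤1+n _) (n≤1+n _)))
    n≡ : suc k + suc g ≡ n
    n≡ = trans (sym (+-suc k (suc g))) (sym n≡k+x)
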